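{- Let $A$ be a primitive subset of a finite vector space $V$ over $\mathbb{F}_3$ which is not a hyperplane. Then $A$ contains an affine subspace whose dimension exceeds $\dim \mathrm{Sym}(A)$.
   Context: $\mathrm{Sym}(A)=\{x\in V: A+x=A\}$ (a linear subspace). A hyperplane is an affine subspace of codimension $1$. For an affine subspace $U$, $[U]=U-U$, $\dim U=\dim[U]$; for $U\subseteq H$, $\dim(H/U)=\dim H-\dim U$; $C(U)$ is the linear span of $U$; $\mathrm{aff}$ is the affine hull. For affine subspaces $U\subseteq H$, $W\subseteq H$ is an $(H,U)$-half if $W+[U]=W$ and $H$ is the disjoint union of $U$, $W$ and $(-U)+(-W)$. Primitive sets (recursively on $\dim V$): $A\subseteq V$ is primitive if either (a) $A$ is a hyperplane not containing $0$, or (b) there exist a hyperplane $H$ with $0\notin H$, a proper affine subspace $U\subsetneq H$, an $(H,U)$-half $W$, and a primitive subset $X$ of $C(U)$ with (i) $A=W\cup X$, (ii) $X\cap[U]=\emptyset$, (iii) $\dim(H/U)\ge2$ or $X\ne -U$, (iv) $\mathrm{aff}(X\cap(-U))=-U$. -}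

module Defs where

open import Data.Nat using (ℕ; zero; suc; _+_; _≤_; _<_)
open import Data.Fin using (Fin; zero; suc)
open import Data.Vec using (Vec; zipWith; map; replicate)
open import Data.Product using (Σ; ∃; _×_; _,_)
open import Data.Sum using (_⊎_)
open import Data.Empty using (⊥)
open import Relation.Nullary using (¬_)
open import Relation.Binary.PropositionalEquality using (_≡_)

F3 : Set
F3 = Fin 3

_+₃_ : F3 → F3 → F3
zero +₃ y = y
suc zero +₃ zero = suc zero
suc zero +₃ suc zero = suc (suc zero)
suc zero +₃ suc (suc zero) = zero
suc (suc zero) +₃ zero = suc (suc zero)
suc (suc zero) +₃ suc zero = zero
suc (suc zero) +₃ suc (suc zero) = suc zero

-₃_ : F3 → F3
-₃ zero = zero
-₃ suc zero = suc (suc zero)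
-₃ suc (suc zero) = suc zero

_*₃_ : F3 → F3 → F3
zero *₃ y = zero
suc zero *₃ y = y
suc (suc zero) *₃ y = -₃ y

one₃ : F3
one₃ = suc zero

-- The vector space V = F₃ⁿ (every finite F₃-vector space is ≅ F₃ⁿ)

V : ℕ → Set
V n = Vec F3 n

0v : ∀ {n} → V n
0v {n} = replicate n zero

_⊕_ : ∀ {n} → V n → V n → V n
_⊕_ = zipWith _+₃_

⊖_ : ∀ {n} → V n → V n
⊖_ = map -₃_

_⊝_ : ∀ {n} → V n → V n → V n
x ⊝ y = x ⊕ (⊖ y)

_·_ : ∀ {n} → F3 → V n → V n
c · x = map (c *₃_) x

Subset : ℕ → Set₁
Subset n = V n → Set

_⟺_ : Set → Set → Set
P ⟺ Q = (P → Q) × (Q → P)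

_⊆_ : ∀ {n} → Subset n → Subset n → Set
A ⊆ B = ∀ x → A x → B x

_≐_ : ∀ {n} → Subset n → Subset n → Set
A ≐ B = ∀ x → A x ⟺ B x

lincomb : ∀ {n} (d : ℕ) → (Fin d → F3) → (Fin d → V n) → V n
lincomb zero    c b = 0v
lincomb (suc d) c b = (c zero · b zero) ⊕ lincomb d (λ i → c (suc i)) (λ i → b (suc i))

sum₃ : (d : ℕ) → (Fin d → F3) → F3
sum₃ zero    c = zero
sum₃ (suc d) c = c zero +₃ sum₃ d (λ i → c (suc i))

C : ∀ {n} → Subset n → Subset n
C {n} U x = Σ ℕ λ d → Σ (Fin d → F3) λ c → Σ (Fin d → V n) λ b →
            (∀ i → U (b i)) × (lincomb d c b ≡ x)

aff : ∀ {n} → Subset n → Subset n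
aff {n} X x = Σ ℕ λ d → Σ (Fin d → F3) λ c → Σ (Fin d → V n) λ b →
              (∀ i → X (b i)) × (sum₃ d c ≡ one₃) × (lincomb d c b ≡ x)

IsLinSub : ∀ {n} → Subset n → Set
IsLinSub L = L 0v × (∀ x y → L x → L y → L (x ⊕ y)) × (∀ c x → L x → L (c · x))

LinIndep : ∀ {n} (d : ℕ) → (Fin d → V n) → Set
LinIndep d b = ∀ c → lincomb d c b ≡ 0v → ∀ i → c i ≡ zero

HasDim : ∀ {n} → Subset n → ℕ → Set
HasDim {n} L d = Σ (Fin d → V n) λ b →
  LinIndep d b × (∀ x → L x ⟺ (Σ (Fin d → F3) λ c → lincomb d c b ≡ x))

IsAffine : ∀ {n} → Subset n → Set
IsAffine {n} U = Σ (V n) λ p → U p × IsLinSub (λ z → U (z ⊕ p))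

Dir : ∀ {n} → Subset n → Subset n
Dir {n} U z = Σ (V n) λ x → Σ (V n) λ y → U x × U y × (z ≡ x ⊝ y)

AffDim : ∀ {n} → Subset n → ℕ → Set
AffDim U d = HasDim (Dir U) d

Neg : ∀ {n} → Subset n → Subset n
Neg U x = U (⊖ x)

NegSum : ∀ {n} → Subset n → Subset n → Subset n
NegSum {n} U W x = Σ (V n) λ u → Σ (V n) λ w → U u × W w × (x ≡ (⊖ u) ⊕ (⊖ w))

Full : ∀ {n} → Subset n
Full x = Data.Unit.⊤
  where import Data.Unit

IsHyperplaneIn : ∀ {n} → Subset n → Subset n → Set
IsHyperplaneIn S H = IsAffine H × (H ⊆ S) ×
  (Σ ℕ λ d → HasDim S (suc d) × AffDim H d)

IsHalf : ∀ {n} → Subset n → Subset n → Subset n → Set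
IsHalf {n} H U W =
  (∀ x → W x ⟺ (Σ (V n) λ w → Σ (V n) λ z → W w × Dir U z × (x ≡ w ⊕ z))) ×
  (∀ x → H x ⟺ (U x ⊎ (W x ⊎ NegSum U W x))) ×
  (∀ x → U x → W x → ⊥) × (∀ x → U x → NegSum U W x → ⊥) ×
  (∀ x → W x → NegSum U W x → ⊥)

data Primitive {n : ℕ} (S : Subset n) : Subset n → Set₁ where
  prim-hyp : ∀ A → IsHyperplaneIn S A → ¬ A 0v → Primitive S A
  prim-ext : ∀ A (H U W X : Subset n) (dH dU : ℕ) →
    IsHyperplaneIn S H → ¬ H 0v →
    IsAffine U → U ⊆ H → (Σ (V n) λ h → H h × ¬ U h) →
    IsHalf H U W →
    Primitive (C U) X →
    A ≐ (λ x → W x ⊎ X x) →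
    (∀ x → X x → Dir U x → ⊥) →
    AffDim H dH → AffDim U dU →
    ((dU + 2 ≤ dH) ⊎ ¬ (X ≐ Neg U)) →
    aff (λ x → X x × Neg U x) ≐ Neg U →
    Primitive S A

Sym : ∀ {n} → Subset n → Subset n
Sym A x = ∀ y → A y ⟺ A (y ⊝ x)

-- A primitive set A that is not a hyperplane is W ∪ X with X ⊆ U ∪ (−U) meeting −U.
-- Every symmetry v of A lies in [U]: for y ∈ X ∩ (−U) the points y ± v lie in A ⊆ H ∪ (−U),
-- and not both in H, as −(y − v) − (y + v) = y ∉ H. Hence dim Sym(A) ≤ dim U.
-- If dim(H/U) ≥ 2, take directions v₁, v₂ of H independent modulo [U]: the half W contains one
-- point of each pair p ± (a v₁ + b v₂), hence a whole line q + F₃ v, and q + F₃ v + [U] ⊆ W has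
-- dimension dim U + 1. Otherwise X ≠ −U, so X is not a hyperplane of C(U), and by induction X
-- contains an affine subspace of dimension > dim Sym(X) ≥ dim Sym(A), because Sym(A) ⊆ Sym(X).
-- All sets involved are decidable, which is what makes dim Sym(A) computable.

module Submission where

open import Defs
open import Data.Nat using (ℕ; zero; suc; _+_; _≤_; _<_; z≤n; s≤s)
open import Data.Nat.Properties using (+-comm; ≤-trans; n≤1+n; ≤-<-trans; <⇒≱; m≤n⇒m≤1+n)
open import Data.Fin using (Fin; zero; suc; _≟_; punchIn)
open import Data.Fin.Properties using (all?; any?)
open import Data.Vec using (Vec; []; _∷_; head)
open import Data.Vec.Properties using (≡-dec)
open import Data.Vec.Functional using (tail) renaming (_∷_ to _◂_)
open import Data.Empty using (⊥; ⊥-elim)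
open import Data.Sum using (_⊎_; inj₁; inj₂; map₂; [_,_])
open import Data.Product using (Σ; _×_; _,_; proj₁; proj₂)
open import Function using (_∘_)
open import Relation.Nullary using (¬_; Dec; yes; no)
open import Relation.Nullary.Decidable using (map′; True; toWitness; ¬?; _×-dec_; _⊎-dec_; _→-dec_; decidable-stable)
open import Relation.Binary.PropositionalEquality hiding ([_])

all-V? : ∀ n {P : V n → Set} → (∀ x → Dec (P x)) → Dec (∀ x → P x)
all-V? zero    P? = map′ (λ p → λ { [] → p }) (λ f → f []) (P? [])
all-V? (suc n) P? = map′ (λ f → λ { (a ∷ x) → f a x }) (λ f a x → f (a ∷ x))
                         (all? λ a → all-V? n λ x → P? (a ∷ x))

-- An identity between expressions in ⊕, ⊖ and · holds in every Vⁿ once it holds in F₃, which the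
-- implicit argument decides by evaluation at all points. Since ⊕, ⊖ and · are zipWith and map,
-- both Coordinatewise hypotheses are proved by refl.
Op : ℕ → Set
Op s = Vec F3 s → ∀ {n} → V n → V n → V n → V n → V n

coordinate : ∀ {s} → Op s → Vec F3 s → V 4 → F3
coordinate F σ (a ∷ b ∷ c ∷ d ∷ []) = head (F σ (a ∷ []) (b ∷ []) (c ∷ []) (d ∷ []))

Coordinatewise : ∀ {s} → Op s → Vec F3 s → Set
Coordinatewise F σ = ∀ {n a b c d} {x y z w : V n} →
  F σ (a ∷ x) (b ∷ y) (c ∷ z) (d ∷ w) ≡ coordinate F σ (a ∷ b ∷ c ∷ d ∷ []) ∷ F σ x y z w

pointwise-identity : ∀ s (F G : Op s)
  {_ : True (all-V? s λ σ → all-V? 4 λ τ → coordinate F σ τ ≟ coordinate G σ τ)} →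
  ∀ σ → Coordinatewise F σ → Coordinatewise G σ →
  ∀ {n} (x y z w : V n) → F σ x y z w ≡ G σ x y z w
pointwise-identity s F G {holds} σ F-coord G-coord [] [] [] [] with F σ [] [] [] [] | G σ [] [] [] []
... | [] | [] = refl
pointwise-identity s F G {holds} σ F-coord G-coord (a ∷ x) (b ∷ y) (c ∷ z) (d ∷ w) = begin
  F σ (a ∷ x) (b ∷ y) (c ∷ z) (d ∷ w)                                  ≡⟨ F-coord ⟩
  coordinate F σ (a ∷ b ∷ c ∷ d ∷ []) ∷ F σ x y z w                   ≡⟨ cong₂ _∷_ (toWitness holds σ _) (pointwise-identity s F G {holds} σ F-coord G-coord x y z w) ⟩
  coordinate G σ (a ∷ b ∷ c ∷ d ∷ []) ∷ G σ x y z w                   ≡⟨ sym G-coord ⟩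
  G σ (a ∷ x) (b ∷ y) (c ∷ z) (d ∷ w) ∎
  where open ≡-Reasoning

·-identityˡ : ∀ {n} (x : V n) → one₃ · x ≡ x
·-identityˡ x = pointwise-identity 0 (λ _ x _ _ _ → one₃ · x) (λ _ x _ _ _ → x) [] refl refl x x x x

zero·≡0v : ∀ {n} (x : V n) → zero · x ≡ 0v
zero·≡0v x = pointwise-identity 0 (λ _ x _ _ _ → zero · x) (λ _ _ _ _ _ → 0v) [] refl refl x x x x

zero·-⊕ : ∀ {n} (x y : V n) → (zero · x) ⊕ y ≡ y
zero·-⊕ x y = pointwise-identity 0 (λ _ x y _ _ → (zero · x) ⊕ y) (λ _ x y _ _ → y) [] refl refl x y x x

⊕-identityˡ : ∀ {n} (x : V n) → 0v ⊕ x ≡ x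
⊕-identityˡ x = pointwise-identity 0 (λ _ x _ _ _ → 0v ⊕ x) (λ _ x _ _ _ → x) [] refl refl x x x x

⊕-identityʳ : ∀ {n} (x : V n) → x ⊕ 0v ≡ x
⊕-identityʳ x = pointwise-identity 0 (λ _ x _ _ _ → x ⊕ 0v) (λ _ x _ _ _ → x) [] refl refl x x x x

⊕-comm : ∀ {n} (x y : V n) → x ⊕ y ≡ y ⊕ x
⊕-comm x y = pointwise-identity 0 (λ _ x y _ _ → x ⊕ y) (λ _ x y _ _ → y ⊕ x) [] refl refl x y x x

⊕-left-comm : ∀ {n} (x y z : V n) → x ⊕ (y ⊕ z) ≡ y ⊕ (x ⊕ z)
⊕-left-comm x y z = pointwise-identity 0 (λ _ x y z _ → x ⊕ (y ⊕ z)) (λ _ x y z _ → y ⊕ (x ⊕ z)) [] refl refl x y z x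

nonzero-square : ∀ {a} → a ≢ zero → a *₃ a ≡ one₃
nonzero-square {zero}           a≢0 = ⊥-elim (a≢0 refl)
nonzero-square {suc zero}       _   = refl
nonzero-square {suc (suc zero)} _   = refl

*₃-identityʳ : ∀ a → a *₃ one₃ ≡ a
*₃-identityʳ zero             = refl
*₃-identityʳ (suc zero)       = refl
*₃-identityʳ (suc (suc zero)) = refl

difference-zero : ∀ a b → a +₃ ((-₃ one₃) *₃ b) ≡ zero → a ≡ b
difference-zero zero             zero             _ = refl
difference-zero (suc zero)       (suc zero)       _ = refl
difference-zero (suc (suc zero)) (suc (suc zero)) _ = refl
difference-zero zero             (suc zero)       ()
difference-zero zero             (suc (suc zero)) ()
difference-zero (suc zero)       zero             ()
difference-zero (suc zero)       (suc (suc zero)) ()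
difference-zero (suc (suc zero)) zero             ()
difference-zero (suc (suc zero)) (suc zero)       ()

pivot-cancel : ∀ a {g} → g ≢ zero → a +₃ ((-₃ (a *₃ g)) *₃ g) ≡ zero
pivot-cancel a                {zero}           g≢0 = ⊥-elim (g≢0 refl)
pivot-cancel zero             {suc zero}       _   = refl
pivot-cancel (suc zero)       {suc zero}       _   = refl
pivot-cancel (suc (suc zero)) {suc zero}       _   = refl
pivot-cancel zero             {suc (suc zero)} _   = refl
pivot-cancel (suc zero)       {suc (suc zero)} _   = refl
pivot-cancel (suc (suc zero)) {suc (suc zero)} _   = refl

-- Linear combinations, spans and dimension

lincomb-cong : ∀ {n} d {c c' : Fin d → F3} {b b' : Fin d → V n} →
  (∀ i → c i ≡ c' i) → (∀ i → b i ≡ b' i) → lincomb d c b ≡ lincomb d c' b'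
lincomb-cong zero    _   _   = refl
lincomb-cong (suc d) c≡c' b≡b' =
  cong₂ _⊕_ (cong₂ _·_ (c≡c' zero) (b≡b' zero)) (lincomb-cong d (c≡c' ∘ suc) (b≡b' ∘ suc))

lincomb-zero : ∀ {n} d (b : Fin d → V n) → lincomb d (λ _ → zero) b ≡ 0v
lincomb-zero zero    b = refl
lincomb-zero (suc d) b = trans (zero·-⊕ (b zero) _) (lincomb-zero d (tail b))

lincomb-+ : ∀ {n} d (c c' : Fin d → F3) (b : Fin d → V n) →
  lincomb d (λ i → c i +₃ c' i) b ≡ lincomb d c b ⊕ lincomb d c' b
lincomb-+ zero    c c' b = sym (⊕-identityʳ 0v)
lincomb-+ (suc d) c c' b =
  trans (cong (((c zero +₃ c' zero) · b zero) ⊕_) (lincomb-+ d (tail c) (tail c') (tail b)))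
        (distrib (c zero) (c' zero) (b zero) _ _)
  where
  distrib : ∀ a a' {n} (x y z : V n) → ((a +₃ a') · x) ⊕ (y ⊕ z) ≡ ((a · x) ⊕ y) ⊕ ((a' · x) ⊕ z)
  distrib a a' x y z = pointwise-identity 2
    (λ { (a ∷ a' ∷ []) x y z _ → ((a +₃ a') · x) ⊕ (y ⊕ z) })
    (λ { (a ∷ a' ∷ []) x y z _ → ((a · x) ⊕ y) ⊕ ((a' · x) ⊕ z) })
    (a ∷ a' ∷ []) refl refl x y z x

lincomb-· : ∀ {n} d a (c : Fin d → F3) (b : Fin d → V n) →
  lincomb d (λ i → a *₃ c i) b ≡ a · lincomb d c b
lincomb-· zero    a c b = pointwise-identity 1 (λ { (a ∷ []) _ _ _ _ → 0v }) (λ { (a ∷ []) _ _ _ _ → a · 0v })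
                            (a ∷ []) refl refl 0v 0v 0v 0v
lincomb-· (suc d) a c b =
  trans (cong (((a *₃ c zero) · b zero) ⊕_) (lincomb-· d a (tail c) (tail b))) (distrib a (c zero) (b zero) _)
  where
  distrib : ∀ a a' {n} (x y : V n) → ((a *₃ a') · x) ⊕ (a · y) ≡ a · ((a' · x) ⊕ y)
  distrib a a' x y = pointwise-identity 2
    (λ { (a ∷ a' ∷ []) x y _ _ → ((a *₃ a') · x) ⊕ (a · y) })
    (λ { (a ∷ a' ∷ []) x y _ _ → a · ((a' · x) ⊕ y) })
    (a ∷ a' ∷ []) refl refl x y x x

lincomb-translate : ∀ {n} d (c s : Fin d → F3) (x : Fin d → V n) (w : V n) →
  lincomb d c (λ i → x i ⊕ (s i · w)) ≡ lincomb d c x ⊕ (sum₃ d (λ i → c i *₃ s i) · w)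
lincomb-translate zero    c s x w = pointwise-identity 0 (λ _ w _ _ _ → 0v) (λ _ w _ _ _ → 0v ⊕ (zero · w)) [] refl refl w w w w
lincomb-translate (suc d) c s x w =
  trans (cong ((c zero · (x zero ⊕ (s zero · w))) ⊕_) (lincomb-translate d (tail c) (tail s) (tail x) w))
        (regroup (c zero) (s zero) _ (x zero) _ w)
  where
  regroup : ∀ a t S {n} (x y w : V n) → (a · (x ⊕ (t · w))) ⊕ (y ⊕ (S · w)) ≡ ((a · x) ⊕ y) ⊕ (((a *₃ t) +₃ S) · w)
  regroup a t S x y w = pointwise-identity 3
    (λ { (a ∷ t ∷ S ∷ []) x y w _ → (a · (x ⊕ (t · w))) ⊕ (y ⊕ (S · w)) })
    (λ { (a ∷ t ∷ S ∷ []) x y w _ → ((a · x) ⊕ y) ⊕ (((a *₃ t) +₃ S) · w) })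
    (a ∷ t ∷ S ∷ []) refl refl x y w x

lincomb-punchIn : ∀ {n} d (j : Fin (suc d)) (c : Fin (suc d) → F3) (b : Fin (suc d) → V n) →
  lincomb (suc d) c b ≡ (c j · b j) ⊕ lincomb d (c ∘ punchIn j) (b ∘ punchIn j)
lincomb-punchIn d       zero    c b = refl
lincomb-punchIn (suc d) (suc j) c b =
  trans (cong ((c zero · b zero) ⊕_) (lincomb-punchIn d j (tail c) (tail b))) (⊕-left-comm _ _ _)

lincomb-closed : ∀ {n} {L : Subset n} → IsLinSub L → ∀ d c b → (∀ i → L (b i)) → L (lincomb d c b)
lincomb-closed (L0 , _  , _ ) zero    c b b∈L = L0
lincomb-closed L@(_ , L+ , L·) (suc d) c b b∈L =
  L+ _ _ (L· (c zero) (b zero) (b∈L zero)) (lincomb-closed L d (tail c) (tail b) (b∈L ∘ suc))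

linSub-cancel : ∀ {n} {L : Subset n} → IsLinSub L → ∀ {a x y} → a ≢ zero → L y → L ((a · x) ⊕ y) → L x
linSub-cancel {L = L} (_ , L+ , L·) {a} {x} {y} a≢0 Ly Lax+y =
  subst L x≡ (L· a _ (L+ _ _ Lax+y (L· (-₃ one₃) y Ly)))
  where
  x≡ : a · (((a · x) ⊕ y) ⊕ ((-₃ one₃) · y)) ≡ x
  x≡ = begin
    a · (((a · x) ⊕ y) ⊕ ((-₃ one₃) · y)) ≡⟨ pointwise-identity 1
                                              (λ { (a ∷ []) x y _ _ → a · (((a · x) ⊕ y) ⊕ ((-₃ one₃) · y)) })
                                              (λ { (a ∷ []) x y _ _ → (a *₃ a) · x })
                                              (a ∷ []) refl refl x y x x ⟩
    (a *₃ a) · x                          ≡⟨ cong (_· x) (nonzero-square a≢0) ⟩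
    one₃ · x                              ≡⟨ ·-identityˡ x ⟩
    x                                     ∎
    where open ≡-Reasoning

Span : ∀ {n} (d : ℕ) → (Fin d → V n) → Subset n
Span {n} d b x = Σ (Fin d → F3) λ c → lincomb d c b ≡ x

span-isLinSub : ∀ {n} d (b : Fin d → V n) → IsLinSub (Span d b)
span-isLinSub d b =
  ((λ _ → zero) , lincomb-zero d b) ,
  (λ { x y (c , refl) (c' , refl) → (λ i → c i +₃ c' i) , lincomb-+ d c c' b }) ,
  (λ { a x (c , refl) → (λ i → a *₃ c i) , lincomb-· d a c b })

span-generator : ∀ {n} d (b : Fin d → V n) i → Span d b (b i)
span-generator (suc d) b zero =
  (one₃ ◂ λ _ → zero) ,
  trans (cong ((one₃ · b zero) ⊕_) (lincomb-zero d (tail b))) (trans (⊕-identityʳ _) (·-identityˡ (b zero)))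
span-generator (suc d) b (suc i) with span-generator d (tail b) i
... | c , c≡ = (zero ◂ c) , trans (zero·-⊕ (b zero) _) c≡

span-tail : ∀ {n} d (b : Fin (suc d) → V n) {x} → Span d (tail b) x → Span (suc d) b x
span-tail d b (c , refl) = (zero ◂ c) , zero·-⊕ (b zero) _

any-coeffs? : ∀ d {P : (Fin d → F3) → Set} → (∀ {c c'} → (∀ i → c i ≡ c' i) → P c → P c') →
  (∀ c → Dec (P c)) → Dec (Σ (Fin d → F3) P)
any-coeffs? zero    resp P? = map′ (_ ,_) (λ { (c , p) → resp (λ ()) p }) (P? λ ())
any-coeffs? (suc d) resp P? =
  map′ (λ { (a , c , p) → (a ◂ c) , p })
       (λ { (c , p) → c zero , tail c , resp (λ { zero → refl ; (suc i) → refl }) p })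
       (any? λ a → any-coeffs? d (λ c≡c' → resp (λ { zero → refl ; (suc i) → c≡c' i })) (P? ∘ (a ◂_)))

span? : ∀ {n} d (b : Fin d → V n) x → Dec (Span d b x)
span? d b x = any-coeffs? d (λ c≡c' → trans (sym (lincomb-cong d c≡c' λ _ → refl))) (λ c → ≡-dec _≟_ (lincomb d c b) x)

-- Nonzero elements of F₃ are their own inverses, so θ j *₃ γ j is θⱼ / γⱼ.
span-eliminate : ∀ {n k} (f : Fin (suc k) → V n) (j : Fin (suc k)) (γ θ : Fin (suc k) → F3) → γ j ≢ zero →
  Span k (f ∘ punchIn j) (lincomb (suc k) θ f ⊕ ((-₃ (θ j *₃ γ j)) · lincomb (suc k) γ f))
span-eliminate {k = k} f j γ θ γj≢0 = h ∘ punchIn j , (begin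
  rest                                                         ≡⟨ sym (zero·-⊕ (f j) rest) ⟩
  (zero · f j) ⊕ rest                                          ≡⟨ cong (λ a → (a · f j) ⊕ rest) (sym (pivot-cancel (θ j) γj≢0)) ⟩
  (h j · f j) ⊕ rest                                           ≡⟨ sym (lincomb-punchIn k j h f) ⟩
  lincomb (suc k) h f                                          ≡⟨ lincomb-+ (suc k) θ (λ l → δ *₃ γ l) f ⟩
  lincomb (suc k) θ f ⊕ lincomb (suc k) (λ l → δ *₃ γ l) f     ≡⟨ cong (lincomb (suc k) θ f ⊕_) (lincomb-· (suc k) δ γ f) ⟩
  lincomb (suc k) θ f ⊕ (δ · lincomb (suc k) γ f)              ∎)
  where
  open ≡-Reasoning
  δ = -₃ (θ j *₃ γ j)
  h : Fin (suc k) → F3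
  h l = θ l +₃ (δ *₃ γ l)
  rest = lincomb k (h ∘ punchIn j) (f ∘ punchIn j)

independent-head-nonzero : ∀ {n} m (b : Fin (suc m) → V n) → LinIndep (suc m) b → b zero ≢ 0v
independent-head-nonzero m b b-indep b0≡0 with b-indep (one₃ ◂ λ _ → zero) one-b0≡0 zero
  where
  one-b0≡0 : lincomb (suc m) (one₃ ◂ λ _ → zero) b ≡ 0v
  one-b0≡0 = trans (cong ((one₃ · b zero) ⊕_) (lincomb-zero m (tail b)))
                   (trans (⊕-identityʳ _) (trans (·-identityˡ (b zero)) b0≡0))
... | ()

independent-injective : ∀ {n} d (b : Fin d → V n) → LinIndep d b →
  ∀ {c c'} → lincomb d c b ≡ lincomb d c' b → ∀ i → c i ≡ c' i
independent-injective d b b-indep {c} {c'} same i =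
  difference-zero (c i) (c' i) (b-indep (λ i → c i +₃ ((-₃ one₃) *₃ c' i)) difference≡0 i)
  where
  difference≡0 : lincomb d (λ i → c i +₃ ((-₃ one₃) *₃ c' i)) b ≡ 0v
  difference≡0 = begin
    lincomb d (λ i → c i +₃ ((-₃ one₃) *₃ c' i)) b ≡⟨ lincomb-+ d c _ b ⟩
    lincomb d c b ⊕ lincomb d (λ i → (-₃ one₃) *₃ c' i) b ≡⟨ cong₂ _⊕_ same (lincomb-· d (-₃ one₃) c' b) ⟩
    lincomb d c' b ⊕ ((-₃ one₃) · lincomb d c' b) ≡⟨ pointwise-identity 0 (λ _ x _ _ _ → x ⊕ ((-₃ one₃) · x)) (λ _ _ _ _ _ → 0v)
                                                         [] refl refl (lincomb d c' b) 0v 0v 0v ⟩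
    0v ∎
    where open ≡-Reasoning

independent-cons : ∀ {n} k (f : Fin k → V n) {v} → LinIndep k f → ¬ Span k f v → LinIndep (suc k) (v ◂ f)
independent-cons k f {v} f-indep v∉ e sum≡0 = λ { zero → e0≡0 ; (suc i) → f-indep (tail e) rest≡0 i }
  where
  e0≡0 : e zero ≡ zero
  e0≡0 = decidable-stable (e zero ≟ zero) λ e0≢0 →
    v∉ (linSub-cancel (span-isLinSub k f) e0≢0 (tail e , refl) (subst (Span k f) (sym sum≡0) (proj₁ (span-isLinSub k f))))
  rest≡0 : lincomb k (tail e) f ≡ 0v
  rest≡0 = trans (sym (zero·-⊕ v _)) (trans (cong (λ a → (a · v) ⊕ lincomb k (tail e) f) (sym e0≡0)) sum≡0)

independent-head-∉-span-tail : ∀ {n} m (b : Fin (suc m) → V n) → LinIndep (suc m) b →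
  ∀ {c} → c zero ≢ zero → ¬ Span m (tail b) (lincomb (suc m) c b)
independent-head-∉-span-tail m b b-indep {c} c0≢0 (g , g≡) =
  c0≢0 (sym (independent-injective (suc m) b b-indep {zero ◂ g} {c} (trans (zero·-⊕ (b zero) _) g≡) zero))

shift-independent : ∀ {n} m (b : Fin (suc m) → V n) (s : Fin m → F3) → LinIndep (suc m) b →
  LinIndep m (λ i → b (suc i) ⊕ (s i · b zero))
shift-independent m b s b-indep e sum≡0 i = b-indep (S ◂ e) total≡0 (suc i)
  where
  S = sum₃ m (λ i → e i *₃ s i)
  total≡0 : lincomb (suc m) (S ◂ e) b ≡ 0v
  total≡0 = trans (⊕-comm _ _) (trans (sym (lincomb-translate m e s (tail b) (b zero))) sum≡0)

independent-in-span⇒≤ : ∀ {n} m k (b : Fin m → V n) (f : Fin k → V n) → LinIndep m b → (∀ i → Span k f (b i)) → m ≤ k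
independent-in-span⇒≤ zero    k       b f _       _   = z≤n
independent-in-span⇒≤ (suc m) zero    b f b-indep b∈f = ⊥-elim (independent-head-nonzero m b b-indep (sym (proj₂ (b∈f zero))))
independent-in-span⇒≤ (suc m) (suc k) b f b-indep b∈f with any? (λ j → ¬? (γ j ≟ zero))
  where γ = proj₁ (b∈f zero)
... | no all-zero = ⊥-elim (independent-head-nonzero m b b-indep (begin
  b zero                                 ≡⟨ sym (proj₂ (b∈f zero)) ⟩
  lincomb (suc k) (proj₁ (b∈f zero)) f   ≡⟨ lincomb-cong (suc k) {c' = λ _ → zero} {b' = f} γ≡0 (λ _ → refl) ⟩
  lincomb (suc k) (λ _ → zero) f         ≡⟨ lincomb-zero (suc k) f ⟩
  0v                                     ∎))
  where
  open ≡-Reasoning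
  γ≡0 : ∀ j → proj₁ (b∈f zero) j ≡ zero
  γ≡0 j = decidable-stable (proj₁ (b∈f zero) j ≟ zero) (λ γj≢0 → all-zero (j , γj≢0))
-- Steinitz exchange: use b zero to eliminate the coordinate j from the remaining vectors.
... | yes (j , γj≢0) = s≤s (independent-in-span⇒≤ m k b' (f ∘ punchIn j) (shift-independent m b s b-indep) b'∈)
  where
  γ : Fin (suc k) → F3
  γ = proj₁ (b∈f zero)
  s : Fin m → F3
  s i = -₃ (proj₁ (b∈f (suc i)) j *₃ γ j)
  b' : Fin m → V _
  b' i = b (suc i) ⊕ (s i · b zero)
  b'∈ : ∀ i → Span k (f ∘ punchIn j) (b' i)
  b'∈ i = subst (Span k (f ∘ punchIn j))
    (cong₂ (λ x y → x ⊕ (s i · y)) (proj₂ (b∈f (suc i))) (proj₂ (b∈f zero)))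
    (span-eliminate f j γ (proj₁ (b∈f (suc i))) γj≢0)

∩-isLinSub : ∀ {n} {L M : Subset n} → IsLinSub L → IsLinSub M → IsLinSub (λ x → L x × M x)
∩-isLinSub (L0 , L+ , L·) (M0 , M+ , M·) =
  (L0 , M0) ,
  (λ x y (Lx , Mx) (Ly , My) → L+ x y Lx Ly , M+ x y Mx My) ,
  (λ a x (Lx , Mx) → L· a x Lx , M· a x Mx)

hasDim-isLinSub : ∀ {n} {L : Subset n} {d} → HasDim L d → IsLinSub L
hasDim-isLinSub {L = L} {d} (β , _ , β-spans) =
  from (proj₁ S-lin) ,
  (λ x y Lx Ly → from (proj₁ (proj₂ S-lin) x y (to Lx) (to Ly))) ,
  (λ a x Lx → from (proj₂ (proj₂ S-lin) a x (to Lx)))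
  where
  S-lin = span-isLinSub d β
  to : ∀ {x} → L x → Span d β x
  to = proj₁ (β-spans _)
  from : ∀ {x} → Span d β x → L x
  from = proj₂ (β-spans _)

independent-tail : ∀ {n} m (b : Fin (suc m) → V n) → LinIndep (suc m) b → LinIndep m (tail b)
independent-tail m b b-indep e e≡0 i = b-indep (zero ◂ e) (trans (zero·-⊕ (b zero) _) e≡0) (suc i)

∃-outside-span : ∀ {n m k} (b : Fin m → V n) → LinIndep m b → (f : Fin k → V n) → k < m →
  Σ (Fin m) λ i → ¬ Span k f (b i)
∃-outside-span {m = m} {k} b b-indep f k<m with any? (λ i → ¬? (span? k f (b i)))
... | yes found = found
... | no  none  = ⊥-elim (<⇒≱ k<m (independent-in-span⇒≤ m k b f b-indep λ i →
                    decidable-stable (span? k f (b i)) (λ b∉ → none (i , b∉))))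

basis-extend : ∀ {n m d} {L : Subset n} (b : Fin (suc m) → V n) → LinIndep (suc m) b → IsLinSub L →
  L ⊆ Span (suc m) b → ∀ cs → cs zero ≢ zero → L (lincomb (suc m) cs b) →
  HasDim (λ x → L x × Span m (tail b) x) d → HasDim L (suc d)
basis-extend {m = m} {d} {L} b b-indep L-lin@(_ , L+ , L·) L⊆ cs cs0≢0 Lxs (β , β-indep , β-spans) =
  (xs ◂ β) , independent-cons d β β-indep xs∉ , λ x → to x , from x
  where
  xs = lincomb (suc m) cs b
  xs∉ : ¬ Span d β xs
  xs∉ xs∈ = independent-head-∉-span-tail m b b-indep {cs} cs0≢0 (proj₂ (proj₂ (β-spans xs) xs∈))
  to : ∀ x → L x → Span (suc d) (xs ◂ β) x
  to x Lx with L⊆ x Lx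
  ... | g , refl = (r ◂ proj₁ y∈β) , (begin
    (r · xs) ⊕ lincomb d (proj₁ y∈β) β ≡⟨ cong ((r · xs) ⊕_) (proj₂ y∈β) ⟩
    (r · xs) ⊕ (x ⊕ ((-₃ r) · xs))      ≡⟨ pointwise-identity 1
                                            (λ { (r ∷ []) x z _ _ → (r · z) ⊕ (x ⊕ ((-₃ r) · z)) })
                                            (λ { (r ∷ []) x z _ _ → x })
                                            (r ∷ []) refl refl x xs x x ⟩
    x                                    ∎)
    where
    open ≡-Reasoning
    r = g zero *₃ cs zero
    y∈β : Span d β (x ⊕ ((-₃ r) · xs))
    y∈β = proj₁ (β-spans _) (L+ _ _ Lx (L· (-₃ r) xs Lxs) , span-eliminate b zero cs g cs0≢0)
  from : ∀ x → Span (suc d) (xs ◂ β) x → L x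
  from x (e , refl) = L+ _ _ (L· (e zero) xs Lxs) (proj₁ (proj₂ (β-spans _) (tail e , refl)))

subspace-dim : ∀ {n} m (b : Fin m → V n) {L : Subset n} → LinIndep m b → IsLinSub L →
  (∀ x → Dec (L x)) → L ⊆ Span m b → Σ ℕ λ d → d ≤ m × HasDim L d
subspace-dim zero b _ L-lin L? L⊆ =
  0 , z≤n , (λ ()) , (λ _ _ ()) , λ x → (λ Lx → L⊆ x Lx) , λ { (_ , refl) → proj₁ L-lin }
subspace-dim (suc m) b {L} b-indep L-lin L? L⊆
  with any-coeffs? (suc m) {Pivot} pivot-resp (λ c → ¬? (c zero ≟ zero) ×-dec L? (lincomb (suc m) c b))
  where
  Pivot : (Fin (suc m) → F3) → Set
  Pivot c = c zero ≢ zero × L (lincomb (suc m) c b)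
  pivot-resp : ∀ {c c'} → (∀ i → c i ≡ c' i) → Pivot c → Pivot c'
  pivot-resp c≡c' (c0≢0 , Lx) =
    (λ c'0≡0 → c0≢0 (trans (c≡c' zero) c'0≡0)) , subst L (lincomb-cong (suc m) {b = b} {b' = b} c≡c' (λ _ → refl)) Lx
... | no none with subspace-dim m (tail b) (independent-tail m b b-indep) L-lin L? L⊆tail
  where
  L⊆tail : L ⊆ Span m (tail b)
  L⊆tail x Lx with L⊆ x Lx
  ... | c , refl = tail c , (begin
    lincomb m (tail c) (tail b)                 ≡⟨ sym (zero·-⊕ (b zero) _) ⟩
    (zero · b zero) ⊕ lincomb m (tail c) (tail b) ≡⟨ cong (λ a → (a · b zero) ⊕ lincomb m (tail c) (tail b)) (sym c0≡0) ⟩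
    lincomb (suc m) c b                         ∎)
    where
    open ≡-Reasoning
    c0≡0 : c zero ≡ zero
    c0≡0 = decidable-stable (c zero ≟ zero) λ c0≢0 → none (c , c0≢0 , Lx)
...   | d , d≤m , dim = d , m≤n⇒m≤1+n d≤m , dim
subspace-dim (suc m) b {L} b-indep L-lin L? L⊆ | yes (cs , cs0≢0 , Lxs)
  with subspace-dim m (tail b) (independent-tail m b b-indep) (∩-isLinSub L-lin (span-isLinSub m (tail b)))
         (λ x → L? x ×-dec span? m (tail b) x) (λ _ → proj₂)
... | d , d≤m , dim = suc d , s≤s d≤m , basis-extend b b-indep L-lin L⊆ cs cs0≢0 Lxs dim

subspace-dim-≤ : ∀ {n} {L M : Subset n} {m} → HasDim M m → IsLinSub L → (∀ x → Dec (L x)) → L ⊆ M →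
  Σ ℕ λ d → d ≤ m × HasDim L d
subspace-dim-≤ {m = m} (β , β-indep , β-spans) L-lin L? L⊆M =
  subspace-dim m β β-indep L-lin L? (λ x Lx → proj₁ (β-spans x) (L⊆M x Lx))

-- Affine subspaces

sum₃-cong : ∀ d {c c' : Fin d → F3} → (∀ i → c i ≡ c' i) → sum₃ d c ≡ sum₃ d c'
sum₃-cong zero    _    = refl
sum₃-cong (suc d) c≡c' = cong₂ _+₃_ (c≡c' zero) (sum₃-cong d (c≡c' ∘ suc))

dir-neg : ∀ {n} {U : Subset n} {z} → Dir U z → Dir U (⊖ z)
dir-neg (x , y , Ux , Uy , refl) = y , x , Uy , Ux ,
  pointwise-identity 0 (λ _ x y _ _ → ⊖ (x ⊝ y)) (λ _ x y _ _ → y ⊝ x) [] refl refl x y x x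

span-⊆ : ∀ {n} {S U : Subset n} → IsLinSub S → U ⊆ S → C U ⊆ S
span-⊆ {S = S} S-lin U⊆S x (d , c , b , b∈U , refl) = lincomb-closed S-lin d c b (λ i → U⊆S _ (b∈U i))

module Affine {n} {U : Subset n} (U-affine : IsAffine U) where

  p : V n
  p = proj₁ U-affine

  p∈U : U p
  p∈U = proj₁ (proj₂ U-affine)

  private
    L-lin = proj₂ (proj₂ U-affine)
    L+ = proj₁ (proj₂ L-lin)
    L· = proj₂ (proj₂ L-lin)

    based : ∀ {x} → U x → U ((x ⊝ p) ⊕ p)
    based {x} = subst U (pointwise-identity 0 (λ _ x p _ _ → x) (λ _ x p _ _ → (x ⊝ p) ⊕ p) [] refl refl x p x x)

  translate : ∀ {x z} → U x → Dir U z → U (x ⊕ z)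
  translate {x} Ux (a , b , Ua , Ub , refl) =
    subst U (pointwise-identity 0
              (λ _ x a b p → ((x ⊝ p) ⊕ ((a ⊝ p) ⊕ ((-₃ one₃) · (b ⊝ p)))) ⊕ p)
              (λ _ x a b p → x ⊕ (a ⊝ b)) [] refl refl x a b p)
      (L+ _ _ (based Ux) (L+ _ _ (based Ua) (L· (-₃ one₃) _ (based Ub))))

  neg-sum : ∀ {a b} → U a → U b → U ((⊖ a) ⊕ (⊖ b))
  neg-sum {a} {b} Ua Ub =
    subst U (pointwise-identity 0
              (λ _ a b p _ → (((-₃ one₃) · (a ⊝ p)) ⊕ ((-₃ one₃) · (b ⊝ p))) ⊕ p)
              (λ _ a b p _ → (⊖ a) ⊕ (⊖ b)) [] refl refl a b p a)
      (L+ _ _ (L· (-₃ one₃) _ (based Ua)) (L· (-₃ one₃) _ (based Ub)))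

  ∌0⇒disjoint-neg : ¬ U 0v → ∀ {x} → U x → ¬ U (⊖ x)
  ∌0⇒disjoint-neg 0∉U {x} Ux U-x = 0∉U (subst U
    (pointwise-identity 0 (λ _ x _ _ _ → (⊖ x) ⊕ (⊖ (⊖ x))) (λ _ _ _ _ _ → 0v) [] refl refl x x x x)
    (neg-sum Ux U-x))

  lincomb-decompose : ∀ d c (b : Fin d → V n) → (∀ i → U (b i)) →
    Σ (V n) λ l → U (l ⊕ p) × (lincomb d c b ≡ l ⊕ (sum₃ d c · p))
  lincomb-decompose d c b b∈U = lincomb d c (λ i → b i ⊝ p) ,
    lincomb-closed L-lin d c _ (based ∘ b∈U) , (begin
    lincomb d c b                                                 ≡⟨ lincomb-cong d (λ _ → refl) (λ i → b≡ (b i)) ⟩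
    lincomb d c (λ i → (b i ⊝ p) ⊕ (one₃ · p))                     ≡⟨ lincomb-translate d c (λ _ → one₃) _ p ⟩
    lincomb d c (λ i → b i ⊝ p) ⊕ (sum₃ d (λ i → c i *₃ one₃) · p) ≡⟨ cong (λ s → lincomb d c (λ i → b i ⊝ p) ⊕ (s · p)) (sum₃-cong d (*₃-identityʳ ∘ c)) ⟩
    lincomb d c (λ i → b i ⊝ p) ⊕ (sum₃ d c · p)                   ∎)
    where
    open ≡-Reasoning
    b≡ : ∀ x → x ≡ (x ⊝ p) ⊕ (one₃ · p)
    b≡ x = pointwise-identity 0 (λ _ x p _ _ → x) (λ _ x p _ _ → (x ⊝ p) ⊕ (one₃ · p)) [] refl refl x p x x

  span-trichotomy : ∀ {x} → C U x → U x ⊎ Neg U x ⊎ Dir U x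
  span-trichotomy (d , c , b , b∈U , refl) with lincomb-decompose d c b b∈U
  ... | l , Ul , x≡ with sum₃ d c
  ... | zero = inj₂ (inj₂ (l ⊕ p , p , Ul , p∈U , trans x≡
          (pointwise-identity 0 (λ _ l p _ _ → l ⊕ (zero · p)) (λ _ l p _ _ → (l ⊕ p) ⊝ p) [] refl refl l p l l)))
  ... | suc zero = inj₁ (subst U (sym (trans x≡ (cong (l ⊕_) (·-identityˡ p)))) Ul)
  ... | suc (suc zero) = inj₂ (inj₁ (subst U (sym (trans (cong ⊖_ x≡)
          (pointwise-identity 0 (λ _ l p _ _ → ⊖ (l ⊕ ((-₃ one₃) · p))) (λ _ l p _ _ → ((-₃ one₃) · l) ⊕ p) [] refl refl l p l l)))
          (L· (-₃ one₃) l Ul)))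

  affine-combination-closed : ∀ d c b → (∀ i → U (b i)) → sum₃ d c ≡ one₃ → U (lincomb d c b)
  affine-combination-closed d c b b∈U Σc≡1 with lincomb-decompose d c b b∈U
  ... | l , Ul , x≡ = subst U (sym (trans x≡ (trans (cong (λ s → l ⊕ (s · p)) Σc≡1) (cong (l ⊕_) (·-identityˡ p))))) Ul

  affine-dec : ∀ {d} → AffDim U d → ∀ x → Dec (U x)
  affine-dec {d} (β , _ , β-spans) x = map′
    (λ x-p∈β → subst U (pointwise-identity 0 (λ _ x p _ _ → p ⊕ (x ⊝ p)) (λ _ x p _ _ → x) [] refl refl x p x x)
                 (translate p∈U (proj₂ (β-spans _) x-p∈β)))
    (λ Ux → proj₁ (β-spans _) (x , p , Ux , p∈U , refl))
    (span? d β (x ⊝ p))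

AffineSpan : ∀ {n} m → V n → (Fin m → V n) → Subset n
AffineSpan {n} m q f x = Σ (Fin m → F3) λ c → lincomb m c f ⊕ q ≡ x

affineSpan-base : ∀ {n} m (q : V n) f → AffineSpan m q f q
affineSpan-base m q f = (λ _ → zero) , trans (cong (_⊕ q) (lincomb-zero m f)) (⊕-identityˡ q)

affineSpan-isAffine : ∀ {n} m (q : V n) f → IsAffine (AffineSpan m q f)
affineSpan-isAffine {n} m q f = q , affineSpan-base m q f ,
  from (proj₁ S-lin) ,
  (λ x y x∈ y∈ → from (proj₁ (proj₂ S-lin) x y (to x∈) (to y∈))) ,
  (λ a x x∈ → from (proj₂ (proj₂ S-lin) a x (to x∈)))
  where
  S-lin = span-isLinSub m f
  cancel : ∀ l → (l ⊕ q) ⊝ q ≡ l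
  cancel l = pointwise-identity 0 (λ _ l q _ _ → (l ⊕ q) ⊝ q) (λ _ l q _ _ → l) [] refl refl l q l l
  to : ∀ {z} → AffineSpan m q f (z ⊕ q) → Span m f z
  to {z} (c , c≡) = c , trans (sym (cancel _)) (trans (cong (_⊝ q) c≡) (cancel z))
  from : ∀ {z} → Span m f z → AffineSpan m q f (z ⊕ q)
  from (c , c≡) = c , cong (_⊕ q) c≡

affineSpan-dim : ∀ {n} m (q : V n) f → LinIndep m f → AffDim (AffineSpan m q f) m
affineSpan-dim {n} m q f f-indep = f , f-indep , λ x → to x , from x
  where
  to : ∀ x → Dir (AffineSpan m q f) x → Span m f x
  to _ (_ , _ , (c , refl) , (c' , refl) , refl) = (λ i → c i +₃ ((-₃ one₃) *₃ c' i)) , (begin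
    lincomb m (λ i → c i +₃ ((-₃ one₃) *₃ c' i)) f         ≡⟨ lincomb-+ m c _ f ⟩
    l ⊕ lincomb m (λ i → (-₃ one₃) *₃ c' i) f              ≡⟨ cong (l ⊕_) (lincomb-· m (-₃ one₃) c' f) ⟩
    l ⊕ ((-₃ one₃) · l')                                   ≡⟨ pointwise-identity 0 (λ _ l l' q _ → l ⊕ ((-₃ one₃) · l'))
                                                                (λ _ l l' q _ → (l ⊕ q) ⊝ (l' ⊕ q)) [] refl refl l l' q q ⟩
    (l ⊕ q) ⊝ (l' ⊕ q)                                     ∎)
    where
    open ≡-Reasoning
    l = lincomb m c f
    l' = lincomb m c' f
  from : ∀ x → Span m f x → Dir (AffineSpan m q f) x
  from x (c , c≡) = x ⊕ q , q , (c , cong (_⊕ q) c≡) , affineSpan-base m q f ,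
    pointwise-identity 0 (λ _ x q _ _ → x) (λ _ x q _ _ → (x ⊕ q) ⊝ q) [] refl refl x q x x

aff-nonempty : ∀ {n} {P : Subset n} {x} → aff P x → Σ (V n) P
aff-nonempty (zero  , _ , _ , _    , () , _)
aff-nonempty (suc d , _ , b , b∈P , _  , _) = b zero , b∈P zero

sym-isLinSub : ∀ {n} (A : Subset n) → IsLinSub (Sym A)
sym-isLinSub {n} A = 0∈ , +∈ , ·∈
  where
  0∈ : Sym A 0v
  0∈ y = subst A (sym (y-0 y)) , subst A (y-0 y)
    where
    y-0 : ∀ y → y ⊝ 0v ≡ y
    y-0 y = pointwise-identity 0 (λ _ y _ _ _ → y ⊝ 0v) (λ _ y _ _ _ → y) [] refl refl y y y y
  +∈ : ∀ x y → Sym A x → Sym A y → Sym A (x ⊕ y)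
  +∈ x y x∈ y∈ z =
    (λ Az → subst A (assoc z x y) (proj₁ (y∈ (z ⊝ x)) (proj₁ (x∈ z) Az))) ,
    (λ Az-x-y → proj₂ (x∈ z) (proj₂ (y∈ (z ⊝ x)) (subst A (sym (assoc z x y)) Az-x-y)))
    where
    assoc : ∀ z x y → (z ⊝ x) ⊝ y ≡ z ⊝ (x ⊕ y)
    assoc z x y = pointwise-identity 0 (λ _ z x y _ → (z ⊝ x) ⊝ y) (λ _ z x y _ → z ⊝ (x ⊕ y)) [] refl refl z x y z
  ·∈ : ∀ a x → Sym A x → Sym A (a · x)
  ·∈ zero x _ = subst (Sym A) (sym (zero·≡0v x)) 0∈
  ·∈ (suc zero) x x∈ = subst (Sym A) (sym (·-identityˡ x)) x∈
  ·∈ (suc (suc zero)) x x∈ = subst (Sym A)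
    (pointwise-identity 0 (λ _ x _ _ _ → x ⊕ x) (λ _ x _ _ _ → (-₃ one₃) · x) [] refl refl x x x x) (+∈ x x x∈ x∈)

sym-dec : ∀ {n} {A : Subset n} → (∀ x → Dec (A x)) → ∀ v → Dec (Sym A v)
sym-dec {n} A? v = all-V? n λ y → (A? y →-dec A? (y ⊝ v)) ×-dec (A? (y ⊝ v) →-dec A? y)

module Half {n} {H U W : Subset n} (half : IsHalf H U W) where

  private
    W≐ = proj₁ half
    H≐ = proj₁ (proj₂ half)
    U∩W = proj₁ (proj₂ (proj₂ half))
    W∩N = proj₂ (proj₂ (proj₂ (proj₂ half)))

  W⊆H : W ⊆ H
  W⊆H x Wx = proj₂ (H≐ x) (inj₂ (inj₁ Wx))

  U∩W=∅ : ∀ {x} → U x → ¬ W x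
  U∩W=∅ = U∩W _

  translate : ∀ {x z} → W x → Dir U z → W (x ⊕ z)
  translate {x} {z} Wx z∈ = proj₂ (W≐ (x ⊕ z)) (x , z , Wx , z∈ , refl)

  half-dec : (∀ x → Dec (H x)) → ∀ x → Dec (W x)
  half-dec H? x with H? x
  ... | no  x∉H = no λ Wx → x∉H (W⊆H x Wx)
  ... | yes x∈H with proj₁ (H≐ x) x∈H
  ...   | inj₁ Ux        = no (U∩W x Ux)
  ...   | inj₂ (inj₁ Wx) = yes Wx
  ...   | inj₂ (inj₂ Nx) = no λ Wx → W∩N x Wx Nx

  -- Over F₃, ⊖ (p ⊕ x) = 2p − x is the reflection of x in p.
  half-or-reflection : ∀ {p x} → U p → H x → ¬ U x → W x ⊎ W (⊖ (p ⊕ x))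
  half-or-reflection {p} {x} Up x∈H x∉U with proj₁ (H≐ x) x∈H
  ... | inj₁ Ux = ⊥-elim (x∉U Ux)
  ... | inj₂ (inj₁ Wx) = inj₁ Wx
  ... | inj₂ (inj₂ (u , w , Uu , Ww , refl)) = inj₂ (subst W
          (pointwise-identity 0 (λ _ p u w _ → w ⊕ (u ⊝ p)) (λ _ p u w _ → ⊖ (p ⊕ ((⊖ u) ⊕ (⊖ w)))) [] refl refl p u w p)
          (translate Ww (u , p , Uu , Up , refl)))

-- Primitive sets

primitive-⊆ : ∀ {n} {S A : Subset n} → Primitive S A → A ⊆ S
primitive-⊆ (prim-hyp A (_ , A⊆S , _) _) = A⊆S
primitive-⊆ (prim-ext A H U W X _ _ (_ , H⊆S , _ , S-dim , _) _ _ U⊆H _ half X-prim A≐ _ _ _ _ _) x Ax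
  with proj₁ (A≐ x) Ax
... | inj₁ Wx = H⊆S x (Half.W⊆H half x Wx)
... | inj₂ Xx = span-⊆ (hasDim-isLinSub S-dim) (λ u Uu → H⊆S u (U⊆H u Uu)) x (primitive-⊆ X-prim x Xx)

primitive-dec : ∀ {n} {S A : Subset n} → Primitive S A → ∀ x → Dec (A x)
primitive-dec (prim-hyp A (A-aff , _ , _ , _ , A-dim) _) = Affine.affine-dec A-aff A-dim
primitive-dec (prim-ext A H U W X _ _ (H-aff , _) _ _ _ _ half X-prim A≐ _ H-dim _ _ _) x =
  map′ (proj₂ (A≐ x)) (proj₁ (A≐ x)) (Half.half-dec half (Affine.affine-dec H-aff H-dim) x ⊎-dec primitive-dec X-prim x)

pair-independent-mod : ∀ {n} k (f : Fin k → V n) {v₁ v₂} → ¬ Span k f v₁ → ¬ Span (suc k) (v₁ ◂ f) v₂ →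
  ∀ a b → Span k f ((a · v₁) ⊕ (b · v₂)) → a ≡ zero × b ≡ zero
pair-independent-mod k f {v₁} {v₂} v₁∉ v₂∉ a b comb∈ with b ≟ zero
... | no b≢0 = ⊥-elim (v₂∉ (linSub-cancel S-lin b≢0 av₁∈ bv₂+av₁∈))
  where
  S-lin = span-isLinSub (suc k) (v₁ ◂ f)
  av₁∈ : Span (suc k) (v₁ ◂ f) (a · v₁)
  av₁∈ = proj₂ (proj₂ S-lin) a v₁ (span-generator (suc k) (v₁ ◂ f) zero)
  bv₂+av₁∈ : Span (suc k) (v₁ ◂ f) ((b · v₂) ⊕ (a · v₁))
  bv₂+av₁∈ = span-tail k (v₁ ◂ f) (subst (Span k f) (⊕-comm _ _) comb∈)
... | yes refl = decidable-stable (a ≟ zero) (λ a≢0 → v₁∉ (linSub-cancel (span-isLinSub k f) a≢0 0v₂∈ comb∈)) , refl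
  where
  0v₂∈ : Span k f (zero · v₂)
  0v₂∈ = subst (Span k f) (sym (zero·≡0v v₂)) (proj₁ (span-isLinSub k f))

Line : (F3 → F3 → Set) → Set
Line P = Σ F3 λ a → Σ F3 λ b → Σ F3 λ da → Σ F3 λ db →
  ¬ (da ≡ zero × db ≡ zero) × (∀ l → P (a +₃ (l *₃ da)) (b +₃ (l *₃ db)))

-- A set containing a point of each pair ±e of nonzero points of F₃² contains an affine line; checked case by case.
line-in-half-plane : ∀ {P : F3 → F3 → Set} → (∀ a b → ¬ (a ≡ zero × b ≡ zero) → P a b ⊎ P (-₃ a) (-₃ b)) → Line P
line-in-half-plane {P} choice = lines
  (choice one₃ zero λ { (() , _) }) (choice zero one₃ λ { (_ , ()) })
  (choice one₃ one₃ λ { (() , _) }) (choice one₃ two λ { (() , _) })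
  where
  two = -₃ one₃
  lines : P one₃ zero ⊎ P two zero → P zero one₃ ⊎ P zero two → P one₃ one₃ ⊎ P two two → P one₃ two ⊎ P two one₃ → Line P
  lines (inj₁ w0) (inj₁ w1) (inj₁ w2) (inj₁ w3) = one₃ , zero , zero , one₃ , (λ { (_ , ()) }) , (λ { zero → w0 ; (suc zero) → w2 ; (suc (suc zero)) → w3 })
  lines (inj₁ w0) (inj₁ w1) (inj₁ w2) (inj₂ w3) = zero , one₃ , one₃ , zero , (λ { (() , _) }) , (λ { zero → w1 ; (suc zero) → w2 ; (suc (suc zero)) → w3 })
  lines (inj₁ w0) (inj₁ w1) (inj₂ w2) (inj₁ w3) = one₃ , zero , one₃ , two , (λ { (() , _) }) , (λ { zero → w0 ; (suc zero) → w2 ; (suc (suc zero)) → w1 })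
  lines (inj₁ w0) (inj₁ w1) (inj₂ w2) (inj₂ w3) = one₃ , zero , one₃ , two , (λ { (() , _) }) , (λ { zero → w0 ; (suc zero) → w2 ; (suc (suc zero)) → w1 })
  lines (inj₁ w0) (inj₂ w1) (inj₁ w2) (inj₁ w3) = one₃ , zero , zero , one₃ , (λ { (_ , ()) }) , (λ { zero → w0 ; (suc zero) → w2 ; (suc (suc zero)) → w3 })
  lines (inj₁ w0) (inj₂ w1) (inj₁ w2) (inj₂ w3) = one₃ , zero , one₃ , one₃ , (λ { (() , _) }) , (λ { zero → w0 ; (suc zero) → w3 ; (suc (suc zero)) → w1 })
  lines (inj₁ w0) (inj₂ w1) (inj₂ w2) (inj₁ w3) = zero , two , one₃ , zero , (λ { (() , _) }) , (λ { zero → w1 ; (suc zero) → w3 ; (suc (suc zero)) → w2 })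
  lines (inj₁ w0) (inj₂ w1) (inj₂ w2) (inj₂ w3) = one₃ , zero , one₃ , one₃ , (λ { (() , _) }) , (λ { zero → w0 ; (suc zero) → w3 ; (suc (suc zero)) → w1 })
  lines (inj₂ w0) (inj₁ w1) (inj₁ w2) (inj₁ w3) = two , zero , one₃ , one₃ , (λ { (() , _) }) , (λ { zero → w0 ; (suc zero) → w1 ; (suc (suc zero)) → w3 })
  lines (inj₂ w0) (inj₁ w1) (inj₁ w2) (inj₂ w3) = zero , one₃ , one₃ , zero , (λ { (() , _) }) , (λ { zero → w1 ; (suc zero) → w2 ; (suc (suc zero)) → w3 })
  lines (inj₂ w0) (inj₁ w1) (inj₂ w2) (inj₁ w3) = two , zero , one₃ , one₃ , (λ { (() , _) }) , (λ { zero → w0 ; (suc zero) → w1 ; (suc (suc zero)) → w3 })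
  lines (inj₂ w0) (inj₁ w1) (inj₂ w2) (inj₂ w3) = two , zero , zero , one₃ , (λ { (_ , ()) }) , (λ { zero → w0 ; (suc zero) → w3 ; (suc (suc zero)) → w2 })
  lines (inj₂ w0) (inj₂ w1) (inj₁ w2) (inj₁ w3) = two , zero , one₃ , two , (λ { (() , _) }) , (λ { zero → w0 ; (suc zero) → w1 ; (suc (suc zero)) → w2 })
  lines (inj₂ w0) (inj₂ w1) (inj₁ w2) (inj₂ w3) = two , zero , one₃ , two , (λ { (() , _) }) , (λ { zero → w0 ; (suc zero) → w1 ; (suc (suc zero)) → w2 })
  lines (inj₂ w0) (inj₂ w1) (inj₂ w2) (inj₁ w3) = zero , two , one₃ , zero , (λ { (() , _) }) , (λ { zero → w1 ; (suc zero) → w3 ; (suc (suc zero)) → w2 })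
  lines (inj₂ w0) (inj₂ w1) (inj₂ w2) (inj₂ w3) = two , zero , zero , one₃ , (λ { (_ , ()) }) , (λ { zero → w0 ; (suc zero) → w3 ; (suc (suc zero)) → w2 })

LargeAffineSubset : ∀ {n} → Subset n → Set₁
LargeAffineSubset {n} A = Σ (Subset n) λ B → IsAffine B × (B ⊆ A) ×
  (Σ ℕ λ d → Σ ℕ λ e → HasDim (Sym A) d × AffDim B e × (d < e))

module Extension {n} {S A H U W X : Subset n} {dH dU : ℕ}
  (H-hyp : IsHyperplaneIn S H) (0∉H : ¬ H 0v) (U-aff : IsAffine U) (U⊆H : U ⊆ H)
  (half : IsHalf H U W) (X-prim : Primitive (C U) X) (A≐ : A ≐ (λ x → W x ⊎ X x))
  (X∩[U]=∅ : ∀ x → X x → Dir U x → ⊥) (H-dim : AffDim H dH) (U-dim : AffDim U dU)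
  (aff[X∩-U]≐-U : aff (λ x → X x × Neg U x) ≐ Neg U) where

  private
    module H = Affine (proj₁ H-hyp)
    module U = Affine U-aff
    module W = Half half

  A? : ∀ x → Dec (A x)
  A? x = map′ (proj₂ (A≐ x)) (proj₁ (A≐ x))
    (W.half-dec (H.affine-dec H-dim) x ⊎-dec primitive-dec X-prim x)

  -U∩H=∅ : ∀ {x} → Neg U x → ¬ H x
  -U∩H=∅ -x∈U x∈H = H.∌0⇒disjoint-neg 0∉H x∈H (U⊆H _ -x∈U)

  X⊆U∪-U : ∀ {x} → X x → U x ⊎ Neg U x
  X⊆U∪-U {x} Xx with U.span-trichotomy (primitive-⊆ X-prim x Xx)
  ... | inj₁ Ux          = inj₁ Ux
  ... | inj₂ (inj₁ -x∈U) = inj₂ -x∈U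
  ... | inj₂ (inj₂ x∈[U]) = ⊥-elim (X∩[U]=∅ x Xx x∈[U])

  X∩W=∅ : ∀ {x} → X x → ¬ W x
  X∩W=∅ {x} Xx Wx with X⊆U∪-U Xx
  ... | inj₁ Ux    = W.U∩W=∅ Ux Wx
  ... | inj₂ -x∈U = -U∩H=∅ -x∈U (W.W⊆H x Wx)

  A⊆H∪-U : ∀ {x} → A x → H x ⊎ Neg U x
  A⊆H∪-U {x} Ax with proj₁ (A≐ x) Ax
  ... | inj₁ Wx = inj₁ (W.W⊆H x Wx)
  ... | inj₂ Xx with X⊆U∪-U Xx
  ...   | inj₁ Ux    = inj₁ (U⊆H x Ux)
  ...   | inj₂ -x∈U = inj₂ -x∈U

  X∩-U-point : Σ (V n) λ y → X y × Neg U y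
  X∩-U-point = aff-nonempty (proj₂ (aff[X∩-U]≐-U (⊖ U.p)) (subst U (sym (⊖-involutive U.p)) U.p∈U))
    where
    ⊖-involutive : ∀ x → ⊖ (⊖ x) ≡ x
    ⊖-involutive x = pointwise-identity 0 (λ _ x _ _ _ → ⊖ (⊖ x)) (λ _ x _ _ _ → x) [] refl refl x x x x

  sym⊆[U] : Sym A ⊆ Dir U
  sym⊆[U] v v∈Sym = from-point X∩-U-point
    where
    from-point : (Σ (V n) λ y → X y × Neg U y) → Dir U v
    from-point (y , Xy , -y∈U) with A⊆H∪-U (proj₁ (v∈Sym y) Ay) | A⊆H∪-U (proj₂ (v∈Sym (y ⊕ v)) (subst A (sym (add-sub y v)) Ay))
      where
      Ay = proj₂ (A≐ y) (inj₂ Xy)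
      add-sub : ∀ y v → (y ⊕ v) ⊝ v ≡ y
      add-sub y v = pointwise-identity 0 (λ _ y v _ _ → (y ⊕ v) ⊝ v) (λ _ y v _ _ → y) [] refl refl y v y y
    ... | inj₂ -[y-v]∈U | _ = ⊖ (y ⊝ v) , ⊖ y , -[y-v]∈U , -y∈U ,
            pointwise-identity 0 (λ _ y v _ _ → v) (λ _ y v _ _ → (⊖ (y ⊝ v)) ⊝ (⊖ y)) [] refl refl y v y y
    ... | inj₁ _ | inj₂ -[y+v]∈U = ⊖ y , ⊖ (y ⊕ v) , -y∈U , -[y+v]∈U ,
            pointwise-identity 0 (λ _ y v _ _ → v) (λ _ y v _ _ → (⊖ y) ⊝ (⊖ (y ⊕ v))) [] refl refl y v y y
    ... | inj₁ y-v∈H | inj₁ y+v∈H = ⊥-elim (-U∩H=∅ -y∈U (subst H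
            (pointwise-identity 0 (λ _ y v _ _ → (⊖ (y ⊝ v)) ⊕ (⊖ (y ⊕ v))) (λ _ y v _ _ → y) [] refl refl y v y y)
            (H.neg-sum y-v∈H y+v∈H)))

  sym-dim : Σ ℕ λ d → d ≤ dU × HasDim (Sym A) d
  sym-dim = subspace-dim-≤ U-dim (sym-isLinSub A) (sym-dec A?) sym⊆[U]

  X≉-U⇒not-hyperplane : ¬ (X ≐ Neg U) → ¬ IsHyperplaneIn (C U) X
  X≉-U⇒not-hyperplane X≉-U (X-aff , _) = X≉-U λ x → X⊆-U , -U⊆X
    where
    module X = Affine X-aff
    X⊆-U : ∀ {x} → X x → Neg U x
    X⊆-U {x} Xx with X⊆U∪-U Xx | X∩-U-point
    ... | inj₂ -x∈U | _ = -x∈U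
    ... | inj₁ Ux | y , Xy , -y∈U = ⊥-elim (X∩[U]=∅ _ (X.neg-sum Xx Xy) (⊖ y , x , -y∈U , Ux ,
            pointwise-identity 0 (λ _ x y _ _ → (⊖ x) ⊕ (⊖ y)) (λ _ x y _ _ → (⊖ y) ⊝ x) [] refl refl x y x x))
    -U⊆X : ∀ {x} → Neg U x → X x
    -U⊆X {x} -x∈U with proj₂ (aff[X∩-U]≐-U x) -x∈U
    ... | d , c , b , b∈ , Σc≡1 , refl = X.affine-combination-closed d c b (proj₁ ∘ b∈) Σc≡1

  sym⊆symX : Sym A ⊆ Sym X
  sym⊆symX v v∈Sym z = forth , back
    where
    v∈[U] = sym⊆[U] v v∈Sym
    forth : X z → X (z ⊝ v)
    forth Xz with proj₁ (A≐ (z ⊝ v)) (proj₁ (v∈Sym z) (proj₂ (A≐ z) (inj₂ Xz)))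
    ... | inj₂ Xz-v = Xz-v
    ... | inj₁ Wz-v = ⊥-elim (X∩W=∅ Xz (subst W
            (pointwise-identity 0 (λ _ z v _ _ → (z ⊝ v) ⊕ v) (λ _ z v _ _ → z) [] refl refl z v z z)
            (W.translate Wz-v v∈[U])))
    back : X (z ⊝ v) → X z
    back Xz-v with proj₁ (A≐ z) (proj₂ (v∈Sym z) (proj₂ (A≐ (z ⊝ v)) (inj₂ Xz-v)))
    ... | inj₂ Xz = Xz
    ... | inj₁ Wz = ⊥-elim (X∩W=∅ Xz-v (W.translate Wz (dir-neg v∈[U])))

  from-X : LargeAffineSubset X → LargeAffineSubset A
  from-X (B , B-aff , B⊆X , d' , e , symX-dim , B-dim , d'<e)
    with subspace-dim-≤ symX-dim (sym-isLinSub A) (sym-dec A?) sym⊆symX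
  ... | d , d≤d' , symA-dim =
    B , B-aff , (λ x Bx → proj₂ (A≐ x) (inj₂ (B⊆X x Bx))) , d , e , symA-dim , B-dim , ≤-<-trans d≤d' d'<e

  module Plane (v₁ v₂ : V n) (v₁∈[H] : Dir H v₁) (v₂∈[H] : Dir H v₂)
    (independent : ∀ a b → Dir U ((a · v₁) ⊕ (b · v₂)) → a ≡ zero × b ≡ zero) where

    point : F3 → F3 → V n
    point a b = U.p ⊕ ((a · v₁) ⊕ (b · v₂))

    point∈W-or-opposite : ∀ a b → ¬ (a ≡ zero × b ≡ zero) → W (point a b) ⊎ W (point (-₃ a) (-₃ b))
    point∈W-or-opposite a b ab≢0 =
      map₂ (subst W (pointwise-identity 2
                      (λ { (a ∷ b ∷ []) p v₁ v₂ _ → ⊖ (p ⊕ (p ⊕ ((a · v₁) ⊕ (b · v₂)))) })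
                      (λ { (a ∷ b ∷ []) p v₁ v₂ _ → p ⊕ (((-₃ a) · v₁) ⊕ ((-₃ b) · v₂)) })
                      (a ∷ b ∷ []) refl refl U.p v₁ v₂ U.p))
        (W.half-or-reflection U.p∈U point∈H point∉U)
      where
      [H]-lin = hasDim-isLinSub H-dim
      point∈H : H (point a b)
      point∈H = H.translate (U⊆H _ U.p∈U)
        (proj₁ (proj₂ [H]-lin) _ _ (proj₂ (proj₂ [H]-lin) a v₁ v₁∈[H]) (proj₂ (proj₂ [H]-lin) b v₂ v₂∈[H]))
      point∉U : ¬ U (point a b)
      point∉U point∈U = ab≢0 (independent a b (point a b , U.p , point∈U , U.p∈U ,
        pointwise-identity 0 (λ _ p x _ _ → x) (λ _ p x _ _ → (p ⊕ x) ⊝ p) [] refl refl U.p ((a · v₁) ⊕ (b · v₂)) U.p U.p))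

    large : LargeAffineSubset A
    large with line-in-half-plane {λ a b → W (point a b)} point∈W-or-opposite | sym-dim
    ... | a , b , da , db , d≢0 , on-line | d , d≤dU , sym-dim =
      AffineSpan (suc dU) (point a b) (v ◂ bU) , affineSpan-isAffine (suc dU) (point a b) (v ◂ bU) , B⊆A ,
      d , suc dU , sym-dim , affineSpan-dim (suc dU) (point a b) (v ◂ bU) (independent-cons dU bU bU-indep v∉[U]) , s≤s d≤dU
      where
      bU = proj₁ U-dim
      bU-indep = proj₁ (proj₂ U-dim)
      [U]≐span = proj₂ (proj₂ U-dim)
      v = (da · v₁) ⊕ (db · v₂)
      v∉[U] : ¬ Span dU bU v
      v∉[U] v∈ = d≢0 (independent da db (proj₂ ([U]≐span v) v∈))
      B⊆A : AffineSpan (suc dU) (point a b) (v ◂ bU) ⊆ A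
      B⊆A _ (c , refl) = proj₂ (A≐ _) (inj₁ (subst W (rearrange (point a b) (c zero · v) l)
        (W.translate (subst W (line-point (c zero)) (on-line (c zero))) (proj₂ ([U]≐span l) (tail c , refl)))))
        where
        l = lincomb dU (tail c) bU
        rearrange : ∀ q x y → (q ⊕ x) ⊕ y ≡ (x ⊕ y) ⊕ q
        rearrange q x y = pointwise-identity 0 (λ _ q x y _ → (q ⊕ x) ⊕ y) (λ _ q x y _ → (x ⊕ y) ⊕ q) [] refl refl q x y q
        line-point : ∀ t → point (a +₃ (t *₃ da)) (b +₃ (t *₃ db)) ≡ point a b ⊕ (t · v)
        line-point t = pointwise-identity 5
          (λ { (a ∷ b ∷ t ∷ da ∷ db ∷ []) p v₁ v₂ _ → p ⊕ (((a +₃ (t *₃ da)) · v₁) ⊕ ((b +₃ (t *₃ db)) · v₂)) })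
          (λ { (a ∷ b ∷ t ∷ da ∷ db ∷ []) p v₁ v₂ _ → (p ⊕ ((a · v₁) ⊕ (b · v₂))) ⊕ (t · ((da · v₁) ⊕ (db · v₂))) })
          (a ∷ b ∷ t ∷ da ∷ db ∷ []) refl refl U.p v₁ v₂ U.p

  large-codim : dU + 2 ≤ dH → LargeAffineSubset A
  large-codim codim≥2 = Plane.large v₁ v₂ (in-[H] i) (in-[H] j) λ a b comb∈[U] →
    pair-independent-mod dU bU v₁∉ v₂∉ a b (proj₁ (proj₂ (proj₂ U-dim) _) comb∈[U])
    where
    bH = proj₁ H-dim
    bU = proj₁ U-dim
    in-[H] : ∀ i → Dir H (bH i)
    in-[H] i = proj₂ (proj₂ (proj₂ H-dim) _) (span-generator dH bH i)
    2+dU≤dH : suc (suc dU) ≤ dH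
    2+dU≤dH = subst (_≤ dH) (+-comm dU 2) codim≥2
    outside₁ = ∃-outside-span bH (proj₁ (proj₂ H-dim)) bU (≤-trans (n≤1+n _) 2+dU≤dH)
    i = proj₁ outside₁
    v₁ = bH i
    v₁∉ = proj₂ outside₁
    outside₂ = ∃-outside-span bH (proj₁ (proj₂ H-dim)) (v₁ ◂ bU) 2+dU≤dH
    j = proj₁ outside₂
    v₂ = bH j
    v₂∉ = proj₂ outside₂

primitive⇒large-affine-subset : ∀ {n} {S A : Subset n} → Primitive S A → ¬ IsHyperplaneIn S A → LargeAffineSubset A
primitive⇒large-affine-subset (prim-hyp A A-hyp _) not-hyp = ⊥-elim (not-hyp A-hyp)
primitive⇒large-affine-subset
  (prim-ext A H U W X _ _ H-hyp 0∉H U-aff U⊆H _ half X-prim A≐ X∩[U]=∅ H-dim U-dim codim≥2-or-X≉-U aff≐) _ =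
  [ E.large-codim , (λ X≉-U → E.from-X (primitive⇒large-affine-subset X-prim (E.X≉-U⇒not-hyperplane X≉-U))) ]
    codim≥2-or-X≉-U
  where module E = Extension H-hyp 0∉H U-aff U⊆H half X-prim A≐ X∩[U]=∅ H-dim U-dim aff≐

lemma2p6 : (n : ℕ) (A : Subset n) → Primitive Full A → ¬ IsHyperplaneIn Full A →
    Σ (Subset n) λ B → IsAffine B × (B ⊆ A) ×
      (Σ ℕ λ d → Σ ℕ λ e → HasDim (Sym A) d × AffDim B e × (d < e))
lemma2p6 n A = primitive⇒large-affine-subset
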